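{- Let $r\ge 3$ be an integer, let $\varphi$ be an instance of \textsc{Exact $r$-SAT}, and let $G(\varphi)$ be the graph constructed from $\varphi$ as described in the context. If $\mathrm{wcol}_r(G(\varphi))\le 2r-1$, then $\varphi$ has a satisfying assignment.
   Context: \textsc{Exact $r$-SAT}: a CNF formula $\varphi$ with clauses $c_1,\dots,c_m$ over variables $x_1,\dots,x_n$ such that each clause contains exactly $r$ different variables. An $\ell$-subdivided edge between $a$ and $b$ is an induced path with $\ell$ new internal vertices (with no other neighbours) joining $a$ and $b$; a $0$-subdivided edge is an ordinary edge. Construction of $G(\varphi)$: for each clause $c_i$ create $2r$ vertices $u_i^1,\dots,u_i^{2r}$. For each variable $x_j$ create two adjacent vertices $v_j$ (for $x_j$) and $v_j'$ (for $\overline{x}_j$). For each clause $c_i$ containing the literal $x_j$, add two $(r-2)$-subdivided edges from $v_j$ to each of $u_i^1,\dots,u_i^{2r}$; for each clause $c_i$ containing $\overline{x}_j$, add two $(r-2)$-subdivided edges from $v_j'$ to each of $u_i^1,\dots,u_i^{2r}$. Weak coloring number: for a total order $\sigma$ on $V(G)$ and $u\neq v$, $v$ is weakly $r$-reachable from $u$ if $v\not<_\sigma u$ and there is a $u$-$v$ path $P$ of length at most $r$ whose internal vertices $p$ all satisfy $p<_\sigma v$; $\mathrm{wreach}_r(u,G_\sigma)$ is the set of such $v$, and $\mathrm{wcol}_r(G)=\min_\sigma\max_u|\mathrm{wreach}_r(u,G_\sigma)|$ over total orders $\sigma$. -}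

module Defs where

open import Data.Nat using (ℕ; zero; suc; _+_; _*_; _∸_; _≤_)
open import Data.Fin using (Fin; toℕ)
open import Data.Bool using (Bool; true; false)
open import Data.Product using (Σ; _×_; _,_; proj₁; proj₂; ∃-syntax)
open import Data.Sum using (_⊎_)
open import Data.List using (List; []; _∷_; _++_; [_]; length)
open import Data.List.Relation.Unary.All using (All)
open import Data.List.Relation.Unary.Linked using (Linked)
open import Data.List.Relation.Unary.Unique.Propositional using (Unique)
open import Relation.Binary.PropositionalEquality using (_≡_; _≢_)
open import Relation.Binary.Core using (Rel)
open import Relation.Binary.Structures using (IsStrictTotalOrder)
open import Relation.Nullary using (¬_)
open import Function.Definitions using (Injective)
open import Level using (0ℓ)

-- A literal over n variables: (variable index, sign); sign true = x_j,
-- sign false = the negated literal ¬x_j.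
Lit : ℕ → Set
Lit n = Fin n × Bool

record ExactSAT (r : ℕ) : Set where
  field
    n       : ℕ
    m       : ℕ
    clause  : Fin m → Fin r → Lit n
    exact   : ∀ i → Injective _≡_ _≡_ (λ p → proj₁ (clause i p))

open ExactSAT public

LitTrue : ∀ {n} → (Fin n → Bool) → Lit n → Set
LitTrue α (j , b) = α j ≡ b

Satisfies : ∀ {r} (φ : ExactSAT r) → (Fin (n φ) → Bool) → Set
Satisfies {r} φ α = ∀ (i : Fin (m φ)) → ∃[ p ] LitTrue α (clause φ i p)

Satisfiable : ∀ {r} → ExactSAT r → Set
Satisfiable φ = ∃[ α ] Satisfies φ α

record Graph : Set₁ where
  field
    V : Set
    E : V → V → Set

open Graph public

-- Path from u to v with list of internal vertices xs: the vertex sequence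
-- u ∷ xs ++ [v] has consecutive vertices adjacent and all vertices distinct.
-- Its length (number of edges) is length xs + 1.
record PathVia (G : Graph) (u v : V G) (xs : List (V G)) : Set where
  field
    adjacent : Linked (E G) (u ∷ xs ++ [ v ])
    distinct : Unique (u ∷ xs ++ [ v ])

record Ordering (G : Graph) : Set₁ where
  field
    _<σ_ : Rel (V G) 0ℓ
    isSTO : IsStrictTotalOrder _≡_ _<σ_

WReach : (G : Graph) → Ordering G → ℕ → V G → V G → Set
WReach G σ r u v =
  u ≢ v × ¬ (v <σ u) ×
  ∃[ xs ] (PathVia G u v xs × length xs + 1 ≤ r × All (λ p → p <σ v) xs)
  where open Ordering σ

CardAtMost : {A : Set} → (A → Set) → ℕ → Set
CardAtMost {A} P k = ∀ (xs : List A) → Unique xs → All P xs → length xs ≤ k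

WcolAtMost : ℕ → Graph → ℕ → Set₁
WcolAtMost r G k =
  Σ (Ordering G) λ σ → ∀ (u : V G) → CardAtMost (WReach G σ r u) k

data GV (r n m : ℕ) : Set where
  -- u_i^k, k ∈ {1..2r}
  clv : Fin m → Fin (2 * r) → GV r n m
  -- v_j (b = true) and v_j' (b = false)
  varv : Fin n → Bool → GV r n m
  -- internal vertex number t (0 ≤ t < r-2) of copy c ∈ {0,1} of the
  -- (r-2)-subdivided edge from the vertex of the literal at position p of
  -- clause i to u_i^k
  subv : (i : Fin m) (p : Fin r) (k : Fin (2 * r)) (c : Fin 2)
         (t : Fin (r ∸ 2)) → GV r n m

-- oriented generating edges
data GAdj {r : ℕ} (φ : ExactSAT r) : GV r (n φ) (m φ) → GV r (n φ) (m φ) → Set where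
  lit-edge : ∀ j → GAdj φ (varv j true) (varv j false)
  path-first : ∀ i p k c (t : Fin (r ∸ 2)) → toℕ t ≡ 0 →
    GAdj φ (varv (proj₁ (clause φ i p)) (proj₂ (clause φ i p))) (subv i p k c t)
  path-mid : ∀ i p k c (t t' : Fin (r ∸ 2)) → suc (toℕ t) ≡ toℕ t' →
    GAdj φ (subv i p k c t) (subv i p k c t')
  path-last : ∀ i p k c (t : Fin (r ∸ 2)) → suc (toℕ t) ≡ r ∸ 2 →
    GAdj φ (subv i p k c t) (clv i k)

G : ∀ {r} → ExactSAT r → Graph
G {r} φ = record
  { V = GV r (n φ) (m φ)
  ; E = λ a b → GAdj φ a b ⊎ GAdj φ b a
  }

{-# OPTIONS --safe #-}
module Submission where

-- Fix an order σ witnessing wcol_r ≤ 2r − 1 and make x_j true iff v_j' <σ v_j.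
-- If a clause c_i were falsified, every literal vertex ℓ of c_i lies below its
-- complement ℓ̄. The σ-maximum of a path of length at most r that starts below
-- its end is weakly r-reachable from its start. Call the subdivided edges
-- spokes and let u be the σ-least of u_i^1, …, u_i^2r. If some ℓ <σ u, the
-- maxima of one spoke from ℓ to each u_i^k are 2r vertices weakly reachable
-- from ℓ. Otherwise u lies below every ℓ; for each literal, the maximum of one
-- spoke from u to ℓ and that of the other spoke extended by the edge ℓℓ̄
-- (which cannot be ℓ) are two distinct vertices weakly reachable from u,
-- again 2r in total.

open import Defs
open import Data.Nat using (ℕ; _≤_; _*_; _∸_)
open import Data.Nat using (zero; suc; _+_; s≤s; z≤n)
open import Data.Nat.Properties
  using (n≮n; n≤1+n; +-comm; ≤-trans; ≤-reflexive; m≤m+n; module ≤-Reasoning)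
open import Data.Fin using (Fin; zero; suc; inject₁; fromℕ; combine; remQuot)
open import Data.Fin.Properties using (toℕ-inject₁; toℕ-fromℕ; combine-remQuot; any?)
open import Data.Bool using (Bool; true; false; not)
open import Data.Bool.Properties using (not-¬) renaming (_≟_ to _≟ᵇ_)
open import Data.Maybe using (Maybe; just; nothing)
open import Data.Maybe.Properties using (just-injective)
open import Data.Product using (_×_; _,_; proj₁; proj₂; ∃-syntax; uncurry)
open import Data.Sum using (_⊎_; inj₁; inj₂; fromInj₂; swap)
open import Data.Empty using (⊥; ⊥-elim)
open import Data.List using (List; []; _∷_; _++_; [_]; length; tabulate; reverse; reverseAcc)
open import Data.List.Properties
  using (length-++; length-tabulate; length-reverse; unfold-reverse; reverse-++)
open import Data.List.Relation.Unary.All as All using (All; []; _∷_)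
import Data.List.Relation.Unary.All.Properties as Allₚ
open import Data.List.Relation.Unary.AllPairs using ([]; _∷_)
open import Data.List.Relation.Unary.Linked using (Linked; []; [-]; _∷_)
open import Data.List.Relation.Unary.Unique.Propositional using (Unique)
open import Data.List.Relation.Unary.Unique.Propositional.Properties using (tabulate⁺; Unique[x∷xs]⇒x∉xs)
import Data.List.Relation.Unary.Unique.Propositional.Properties as Unique
open import Data.List.Relation.Unary.Any using (here)
open import Data.List.Membership.Propositional using (_∈_)
open import Data.List.Membership.Propositional.Properties using (∈-++⁺ˡ; ∈-++⁺ʳ)
open import Data.List.Relation.Binary.Permutation.Setoid as Permutation using ()
open import Data.List.Relation.Binary.Permutation.Setoid.Properties as PermutationProperties using ()
open import Function using (_∘_)
open import Relation.Binary.Core using (Rel)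
open import Relation.Binary.Definitions using (Symmetric; tri<; tri≈; tri>)
open import Relation.Binary.Structures using (IsStrictTotalOrder)
open import Relation.Binary.PropositionalEquality
  using (_≡_; _≢_; refl; sym; trans; cong; subst; setoid; module ≡-Reasoning)
open import Relation.Nullary using (¬_; yes; no; does; contradiction)
open import Level using (0ℓ)

module _ {A : Set} where

  open Permutation (setoid A) using (↭-sym)
  open PermutationProperties (setoid A) using (↭-reverse; All-resp-↭; Unique-resp-↭)

  Linked-++⁻ˡ : ∀ {R : Rel A 0ℓ} xs {ys} → Linked R (xs ++ ys) → Linked R xs
  Linked-++⁻ˡ []           _         = []
  Linked-++⁻ˡ (x ∷ [])     _         = [-]
  Linked-++⁻ˡ (x ∷ y ∷ xs) (Rxy ∷ l) = Rxy ∷ Linked-++⁻ˡ (y ∷ xs) l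

  Linked-∷ʳ : ∀ {R : Rel A 0ℓ} {y z} xs → Linked R (xs ++ [ y ]) → R y z →
              Linked R ((xs ++ [ y ]) ++ [ z ])
  Linked-∷ʳ []           [-]       Ryz = Ryz ∷ [-]
  Linked-∷ʳ (x ∷ [])     (Rxy ∷ l) Ryz = Rxy ∷ Linked-∷ʳ [] l Ryz
  Linked-∷ʳ (x ∷ w ∷ xs) (Rxw ∷ l) Ryz = Rxw ∷ Linked-∷ʳ (w ∷ xs) l Ryz

  Linked-reverseAcc : ∀ {R : Rel A 0ℓ} → Symmetric R → ∀ {x acc} xs →
                      Linked R (x ∷ xs) → Linked R (x ∷ acc) → Linked R (reverseAcc (x ∷ acc) xs)
  Linked-reverseAcc sym []       _         l = l
  Linked-reverseAcc sym (y ∷ ys) (Rxy ∷ l) l′ = Linked-reverseAcc sym ys l (sym Rxy ∷ l′)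

  Linked-reverse : ∀ {R : Rel A 0ℓ} → Symmetric R → ∀ {xs} → Linked R xs → Linked R (reverse xs)
  Linked-reverse sym {[]}     _ = []
  Linked-reverse sym {x ∷ xs} l = Linked-reverseAcc sym xs l [-]

  Linked-tabulate : ∀ {R : Rel A 0ℓ} {n a b} (f : Fin (suc n) → A) →
                    R a (f zero) → (∀ i → R (f (inject₁ i)) (f (suc i))) → R (f (fromℕ n)) b →
                    Linked R (a ∷ tabulate f ++ [ b ])
  Linked-tabulate {n = zero}  f Raf _   Rfb = Raf ∷ Rfb ∷ [-]
  Linked-tabulate {n = suc n} f Raf Rff Rfb = Raf ∷ Linked-tabulate (f ∘ suc) (Rff zero) (Rff ∘ suc) Rfb

  Unique-++⁻ˡ : ∀ xs {ys : List A} → Unique (xs ++ ys) → Unique xs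
  Unique-++⁻ˡ []       _         = []
  Unique-++⁻ˡ (x ∷ xs) (x∉ ∷ u) = Allₚ.++⁻ˡ xs x∉ ∷ Unique-++⁻ˡ xs u

  Unique-∷ʳ : ∀ {xs : List A} {y} → Unique xs → All (_≢ y) xs → Unique (xs ++ [ y ])
  Unique-∷ʳ u ≢y = Unique.++⁺ u ([] ∷ []) λ { (x∈ , here refl) → All.lookup ≢y x∈ refl }

  Unique-reverse : ∀ {xs : List A} → Unique xs → Unique (reverse xs)
  Unique-reverse = Unique-resp-↭ (↭-sym (↭-reverse _))

  All-reverse : ∀ {P : A → Set} {xs} → All P xs → All P (reverse xs)
  All-reverse = All-resp-↭ (subst _) (↭-sym (↭-reverse _))

  reverse-∷-∷ʳ : ∀ (u : A) xs v → reverse (u ∷ xs ++ [ v ]) ≡ v ∷ reverse xs ++ [ u ]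
  reverse-∷-∷ʳ u xs v = begin
    reverse (u ∷ xs ++ [ v ])      ≡⟨ unfold-reverse u (xs ++ [ v ]) ⟩
    reverse (xs ++ [ v ]) ++ [ u ] ≡⟨ cong (_++ [ u ]) (reverse-++ xs [ v ]) ⟩
    v ∷ reverse xs ++ [ u ]        ∎
    where open ≡-Reasoning

module _ {A : Set} {_<_ : Rel A 0ℓ} (sto : IsStrictTotalOrder _≡_ _<_) where

  open IsStrictTotalOrder sto using (compare; asym; irrefl; _<?_) renaming (trans to <-trans)

  ≮∧≢⇒> : ∀ {x y} → ¬ x < y → x ≢ y → y < x
  ≮∧≢⇒> {x} {y} x≮y x≢y with compare x y
  ... | tri< x<y _ _ = contradiction x<y x≮y
  ... | tri≈ _ x≡y _ = contradiction x≡y x≢y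
  ... | tri> _ _ y<x = y<x

  <-≮-trans : ∀ {x y z} → x < y → ¬ z < y → x < z
  <-≮-trans {x} {y} {z} x<y z≮y with compare y z
  ... | tri< y<z _ _ = <-trans x<y y<z
  ... | tri≈ _ refl _ = x<y
  ... | tri> _ _ z<y = contradiction z<y z≮y

  ∃-minimum : ∀ {n} (f : Fin (suc n) → A) → ∃[ k ] (∀ k′ → ¬ f k′ < f k)
  ∃-minimum {zero}  f = zero , λ { zero → irrefl refl }
  ∃-minimum {suc n} f with ∃-minimum (f ∘ suc)
  ... | k , minimal with f zero <? f (suc k)
  ...   | yes f0<fk = zero , λ { zero → irrefl refl ; (suc k′) fk′<f0 → minimal k′ (<-trans fk′<f0 f0<fk) }
  ...   | no f0≮fk  = suc k , λ { zero → f0≮fk ; (suc k′) → minimal k′ }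

  record MaximumSplit (ys : List A) : Set where
    field
      before  : List A
      maximum : A
      after   : List A
      split   : ys ≡ (before ++ [ maximum ]) ++ after
      below   : All (_< maximum) before
      maximal : All (λ y → ¬ maximum < y) ys

  ∷-maximumSplit : ∀ x {ys} → MaximumSplit ys → MaximumSplit (x ∷ ys)
  ∷-maximumSplit x {ys} record { before = bs ; maximum = m ; after = as
                               ; split = eq ; below = bs<m ; maximal = m-max }
    with x <? m
  ... | yes x<m = record { before = x ∷ bs ; maximum = m ; after = as ; split = cong (x ∷_) eq
                         ; below = x<m ∷ bs<m ; maximal = asym x<m ∷ m-max }
  ... | no x≮m  = record { before = [] ; maximum = x ; after = ys ; split = refl ; below = []
                         ; maximal = irrefl refl ∷ All.map (λ m≮y x<y → x≮m (<-≮-trans x<y m≮y)) m-max }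

  maximumSplit : ∀ xs v → MaximumSplit (xs ++ [ v ])
  maximumSplit []       v = record { before = [] ; maximum = v ; after = [] ; split = refl
                                   ; below = [] ; maximal = irrefl refl ∷ [] }
  maximumSplit (x ∷ xs) v = ∷-maximumSplit x (maximumSplit xs v)

module _ {Γ : Graph} where

  PathVia-reverse : (∀ {a b} → E Γ a b → E Γ b a) →
                    ∀ {u v xs} → PathVia Γ u v xs → PathVia Γ v u (reverse xs)
  PathVia-reverse sym {u} {v} {xs} p = record
    { adjacent = subst (Linked (E Γ)) (reverse-∷-∷ʳ u xs v) (Linked-reverse sym adjacent)
    ; distinct = subst Unique (reverse-∷-∷ʳ u xs v) (Unique-reverse distinct)
    }
    where open PathVia p

  PathVia-∷ʳ : ∀ {u v w xs} → PathVia Γ u v xs → E Γ v w → All (_≢ w) (u ∷ xs ++ [ v ]) →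
               PathVia Γ u w (xs ++ [ v ])
  PathVia-∷ʳ {u} {xs = xs} p Evw w∉ = record
    { adjacent = Linked-∷ʳ (u ∷ xs) (PathVia.adjacent p) Evw
    ; distinct = Unique-∷ʳ (PathVia.distinct p) w∉
    }

  PathVia-prefix : ∀ {u v z xs} ps {rest} → PathVia Γ u v xs →
                   xs ++ [ v ] ≡ (ps ++ [ z ]) ++ rest → PathVia Γ u z ps
  PathVia-prefix {u} {z = z} ps p eq = record
    { adjacent = Linked-++⁻ˡ (u ∷ ps ++ [ z ]) (subst (λ ys → Linked (E Γ) (u ∷ ys)) eq adjacent)
    ; distinct = Unique-++⁻ˡ (u ∷ ps ++ [ z ]) (subst (λ ys → Unique (u ∷ ys)) eq distinct)
    }
    where open PathVia p

  module _ (σ : Ordering Γ) (r : ℕ) where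

    open Ordering σ
    open IsStrictTotalOrder isSTO using () renaming (trans to <-trans)

    wreach-path-maximum : ∀ {u v xs} → PathVia Γ u v xs → length xs + 1 ≤ r → u <σ v →
                          ∃[ z ] z ∈ xs ++ [ v ] × ¬ z <σ v × WReach Γ σ r u z
    wreach-path-maximum {u} {v} {xs} p short u<v =
      maximum , maximum∈ , maximum≮v , u≢maximum , (λ m<u → maximum≮v (<-trans m<u u<v)) ,
      before , PathVia-prefix before p split , prefix-short , below
      where
      open MaximumSplit (maximumSplit isSTO xs v)
      maximum∈ : maximum ∈ xs ++ [ v ]
      maximum∈ = subst (maximum ∈_) (sym split) (∈-++⁺ˡ (∈-++⁺ʳ before (here refl)))
      maximum≮v : ¬ maximum <σ v
      maximum≮v = All.lookup maximal (∈-++⁺ʳ xs (here refl))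
      u≢maximum : u ≢ maximum
      u≢maximum refl = Unique[x∷xs]⇒x∉xs (PathVia.distinct p) maximum∈
      prefix-short : length before + 1 ≤ r
      prefix-short = begin
        length before + 1                             ≡⟨ length-++ before ⟨
        length (before ++ [ maximum ])                ≤⟨ m≤m+n _ (length after) ⟩
        length (before ++ [ maximum ]) + length after ≡⟨ length-++ (before ++ [ maximum ]) ⟨
        length ((before ++ [ maximum ]) ++ after)     ≡⟨ cong length split ⟨
        length (xs ++ [ v ])                          ≡⟨ length-++ xs ⟩
        length xs + 1                                 ≤⟨ short ⟩
        r                                             ∎
        where open ≤-Reasoning

CardAtMost-labelled : ∀ {A : Set} {P : A → Set} {c k} → CardAtMost P c →
                      (L : Fin k → A → Set) → (∀ {s t x} → L s x → L t x → s ≡ t) →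
                      (∀ t → ∃[ x ] L t x × P x) → k ≤ c
CardAtMost-labelled {A} {c = c} {k} bound L functional labelled =
  subst (_≤ c) (length-tabulate f)
    (bound (tabulate f) (tabulate⁺ f-injective) (Allₚ.tabulate⁺ (proj₂ ∘ proj₂ ∘ labelled)))
  where
  f : Fin k → A
  f = proj₁ ∘ labelled
  f-injective : ∀ {s t} → f s ≡ f t → s ≡ t
  f-injective {s} {t} eq =
    functional (proj₁ (proj₂ (labelled s))) (subst (L t) (sym eq) (proj₁ (proj₂ (labelled t))))

remQuot-injective : ∀ {n} k {a b : Fin (n * k)} → remQuot {n} k a ≡ remQuot {n} k b → a ≡ b
remQuot-injective {n} k {a} {b} eq = begin
  a                                 ≡⟨ combine-remQuot {n} k a ⟨
  uncurry combine (remQuot {n} k a) ≡⟨ cong (uncurry combine) eq ⟩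
  uncurry combine (remQuot {n} k b) ≡⟨ combine-remQuot {n} k b ⟩
  b                                 ∎
  where open ≡-Reasoning

module _ {s : ℕ} (φ : ExactSAT (3 + s)) where

  private
    r : ℕ
    r = 3 + s

  Vertex : Set
  Vertex = V (G φ)

  E-sym : ∀ {a b} → E (G φ) a b → E (G φ) b a
  E-sym = swap

  varv-injective : ∀ {j j′ b b′} → varv {r} {n φ} {m φ} j b ≡ varv j′ b′ → j ≡ j′ × b ≡ b′
  varv-injective refl = refl , refl

  varv-complement-edge : ∀ j b → E (G φ) (varv j b) (varv j (not b))
  varv-complement-edge j true  = inj₁ (lit-edge j)
  varv-complement-edge j false = inj₂ (lit-edge j)

  varv-≢-complement : ∀ j b → varv {r} {n φ} {m φ} j b ≢ varv j (not b)
  varv-≢-complement j b eq = not-¬ refl (proj₂ (varv-injective eq))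

  literal complement : Fin (m φ) → Fin r → Vertex
  literal    i q = varv (proj₁ (clause φ i q)) (proj₂ (clause φ i q))
  complement i q = varv (proj₁ (clause φ i q)) (not (proj₂ (clause φ i q)))

  spoke : Fin (m φ) → Fin r → Fin (2 * r) → Fin 2 → List Vertex
  spoke i q k c = tabulate (subv i q k c)

  spoke-path : ∀ i q k c → PathVia (G φ) (literal i q) (clv i k) (spoke i q k c)
  spoke-path i q k c = record
    { adjacent = Linked-tabulate sub
        (inj₁ (path-first i q k c zero refl))
        (λ t → inj₁ (path-mid i q k c (inject₁ t) (suc t) (cong suc (toℕ-inject₁ t))))
        (inj₁ (path-last i q k c (fromℕ s) (cong suc (toℕ-fromℕ s))))
    ; distinct = Allₚ.++⁺ (Allₚ.tabulate⁺ {f = sub} λ _ ()) ((λ ()) ∷ [])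
               ∷ Unique-∷ʳ (tabulate⁺ sub-injective) (Allₚ.tabulate⁺ {f = sub} λ _ ())
    }
    where
    sub : Fin (suc s) → Vertex
    sub = subv i q k c
    sub-injective : ∀ {t t′} → sub t ≡ sub t′ → t ≡ t′
    sub-injective refl = refl

  ≤2+s⇒+1≤r : ∀ {ℓ} → ℓ ≤ 2 + s → ℓ + 1 ≤ r
  ≤2+s⇒+1≤r {ℓ} h = subst (_≤ r) (+-comm 1 ℓ) (s≤s h)

  reverse-spoke-length : ∀ i q k c → length (reverse (spoke i q k c)) ≡ suc s
  reverse-spoke-length i q k c = trans (length-reverse (spoke i q k c)) (length-tabulate (subv i q k c))

  spoke-fits : ∀ i q k c → length (spoke i q k c) + 1 ≤ r
  spoke-fits i q k c = ≤2+s⇒+1≤r (≤-trans (≤-reflexive (length-tabulate (subv i q k c))) (n≤1+n _))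

  reverse-spoke-fits : ∀ i q k c → length (reverse (spoke i q k c)) + 1 ≤ r
  reverse-spoke-fits i q k c = ≤2+s⇒+1≤r (≤-trans (≤-reflexive (reverse-spoke-length i q k c)) (n≤1+n _))

  reverse-spoke-∷ʳ-fits : ∀ i q k c x → length (reverse (spoke i q k c) ++ [ x ]) + 1 ≤ r
  reverse-spoke-∷ʳ-fits i q k c x = ≤2+s⇒+1≤r (≤-reflexive (begin
    length (reverse (spoke i q k c) ++ [ x ]) ≡⟨ length-++ (reverse (spoke i q k c)) ⟩
    length (reverse (spoke i q k c)) + 1     ≡⟨ cong (_+ 1) (reverse-spoke-length i q k c) ⟩
    suc s + 1                                ≡⟨ cong suc (+-comm s 1) ⟩
    2 + s                                    ∎))
    where open ≡-Reasoning

  column : Vertex → Maybe (Fin (2 * r))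
  column (clv _ k)        = just k
  column (subv _ _ k _ _) = just k
  column (varv _ _)       = nothing

  -- Copy 1 of a spoke shares its label with the literal vertex, copy 0 with
  -- the complementary vertex, which is reached by extending copy 0.
  side : Fin 2 → Bool → Bool
  side zero       b = not b
  side (suc zero) b = b

  terminal : Fin (m φ) → Fin 2 → Fin r → Vertex
  terminal i c q = varv (proj₁ (clause φ i q)) (side c (proj₂ (clause φ i q)))

  side-injective : ∀ {c c′ b} → side c b ≡ side c′ b → c ≡ c′
  side-injective {zero}     {zero}     _ = refl
  side-injective {suc zero} {suc zero} _ = refl
  side-injective {zero}     {suc zero} e = ⊥-elim (not-¬ refl (sym e))
  side-injective {suc zero} {zero}     e = ⊥-elim (not-¬ refl e)

  terminal-injective : ∀ i {c c′ q q′} → terminal i c q ≡ terminal i c′ q′ → (c , q) ≡ (c′ , q′)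
  terminal-injective i eq with varv-injective eq
  ... | same-variable , same-sign with exact φ i same-variable
  ... | refl = cong (_, _) (side-injective same-sign)

  SpokeLabel : Fin (m φ) → Fin 2 × Fin r → Vertex → Set
  SpokeLabel i (c , q) (subv _ p _ c′ _) = p ≡ q × c′ ≡ c
  SpokeLabel i (c , q) (varv j b)        = varv j b ≡ terminal i c q
  SpokeLabel i (c , q) (clv _ _)         = ⊥

  SpokeLabel-functional : ∀ i {a b x} → SpokeLabel i a x → SpokeLabel i b x → a ≡ b
  SpokeLabel-functional i {x = subv _ _ _ _ _} (refl , refl) (refl , refl) = refl
  SpokeLabel-functional i {x = varv _ _}       eq            eq′           =
    terminal-injective i (trans (sym eq) eq′)

  module _ (σ : Ordering (G φ)) (bound : ∀ u → CardAtMost (WReach (G φ) σ r u) (2 * r ∸ 1)) where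

    open Ordering σ
    open IsStrictTotalOrder isSTO using (_<?_) renaming (trans to <-trans)

    ¬wreach-2r-labelled : ∀ u (L : Fin (2 * r) → Vertex → Set) →
                          (∀ {a b x} → L a x → L b x → a ≡ b) →
                          ¬ (∀ t → ∃[ z ] L t z × WReach (G φ) σ r u z)
    ¬wreach-2r-labelled u L functional labelled =
      n≮n _ (CardAtMost-labelled (bound u) L functional labelled)

    ¬literal<clauseVertices : ∀ i q → ¬ (∀ k → literal i q <σ clv i k)
    ¬literal<clauseVertices i q ℓ<u =
      ¬wreach-2r-labelled (literal i q) (λ k x → column x ≡ just k)
        (λ col col′ → just-injective (trans (sym col) col′)) reach-column
      where
      reach-column : ∀ k → ∃[ z ] column z ≡ just k × WReach (G φ) σ r (literal i q) z
      reach-column k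
        with wreach-path-maximum σ r (spoke-path i q k zero) (spoke-fits i q k zero) (ℓ<u k)
      ... | z , z∈ , _ , wr = z , All.lookup in-column z∈ , wr
        where
        in-column : All (λ x → column x ≡ just k) (spoke i q k zero ++ [ clv i k ])
        in-column = Allₚ.++⁺ (Allₚ.tabulate⁺ {f = subv i q k zero} λ _ → refl) (refl ∷ [])

    ¬clauseVertex<literals : ∀ i k → (∀ q → literal i q <σ complement i q) →
                             ¬ (∀ q → clv i k <σ literal i q)
    ¬clauseVertex<literals i k ℓ<ℓ̄ u<ℓ =
      ¬wreach-2r-labelled (clv i k) (SpokeLabel i ∘ remQuot {2} r)
        (λ la lb → remQuot-injective {2} r (SpokeLabel-functional i la lb))
        (reach-labelled ∘ remQuot {2} r)
      where
      backward : ∀ q c → PathVia (G φ) (clv i k) (literal i q) (reverse (spoke i q k c))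
      backward q c = PathVia-reverse E-sym (spoke-path i q k c)

      extended : ∀ q → PathVia (G φ) (clv i k) (complement i q)
                               (reverse (spoke i q k zero) ++ [ literal i q ])
      extended q = PathVia-∷ʳ (backward q zero) (varv-complement-edge _ _)
        ((λ ()) ∷ Allₚ.++⁺ (All-reverse (Allₚ.tabulate⁺ {f = subv i q k zero} λ _ ()))
                           (varv-≢-complement _ _ ∷ []))

      backward-labelled : ∀ q → All (SpokeLabel i (suc zero , q))
                                    (reverse (spoke i q k (suc zero)) ++ [ literal i q ])
      backward-labelled q = Allₚ.++⁺
        (All-reverse (Allₚ.tabulate⁺ {f = subv i q k (suc zero)} λ _ → refl , refl))
        (refl ∷ [])

      extended-labelled : ∀ q → All (λ x → x ≡ literal i q ⊎ SpokeLabel i (zero , q) x)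
                                    ((reverse (spoke i q k zero) ++ [ literal i q ])
                                       ++ [ complement i q ])
      extended-labelled q = Allₚ.++⁺
        (Allₚ.++⁺ (All-reverse (Allₚ.tabulate⁺ {f = subv i q k zero} λ _ → inj₂ (refl , refl)))
                  (inj₁ refl ∷ []))
        (inj₂ refl ∷ [])

      reach-labelled : ∀ cq → ∃[ z ] SpokeLabel i cq z × WReach (G φ) σ r (clv i k) z
      reach-labelled (suc zero , q)
        with wreach-path-maximum σ r (backward q (suc zero)) (reverse-spoke-fits i q k (suc zero)) (u<ℓ q)
      ... | z , z∈ , _ , wr = z , All.lookup (backward-labelled q) z∈ , wr
      reach-labelled (zero , q)
        with wreach-path-maximum σ r (extended q) (reverse-spoke-∷ʳ-fits i q k zero (literal i q))
               (<-trans (u<ℓ q) (ℓ<ℓ̄ q))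
      ... | z , z∈ , z≮ℓ̄ , wr = z , fromInj₂ (⊥-elim ∘ z≢ℓ) (All.lookup (extended-labelled q) z∈) , wr
        where
        z≢ℓ : z ≢ literal i q
        z≢ℓ refl = z≮ℓ̄ (ℓ<ℓ̄ q)

    assignment : Fin (n φ) → Bool
    assignment j = does (varv j false <? varv j true)

    false-literal-below : ∀ j b → assignment j ≢ b → varv j b <σ varv j (not b)
    false-literal-below j b with varv j false <? varv j true
    false-literal-below j false | yes f<t = λ _ → f<t
    false-literal-below j true  | yes _   = λ ≢true → contradiction refl ≢true
    false-literal-below j false | no _    = λ ≢false → contradiction refl ≢false
    false-literal-below j true  | no f≮t  = λ _ → ≮∧≢⇒> isSTO f≮t λ ()

    ¬falsified : ∀ i → ¬ (∀ q → literal i q <σ complement i q)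
    ¬falsified i ℓ<ℓ̄ with ∃-minimum isSTO (clv i)
    ... | k , minimal with any? (λ q → literal i q <? clv i k)
    ...   | yes (q , ℓ<u) = ¬literal<clauseVertices i q (λ k′ → <-≮-trans isSTO ℓ<u (minimal k′))
    ...   | no ∄ℓ<u      = ¬clauseVertex<literals i k ℓ<ℓ̄ (λ q → ≮∧≢⇒> isSTO (∄ℓ<u ∘ (q ,_)) λ ())

    assignment-satisfies : Satisfies φ assignment
    assignment-satisfies i
      with any? (λ p → assignment (proj₁ (clause φ i p)) ≟ᵇ proj₂ (clause φ i p))
    ... | yes satisfied = satisfied
    ... | no unsatisfied = ⊥-elim (¬falsified i λ q → false-literal-below _ _ (unsatisfied ∘ (q ,_)))

lemma4 : (r : ℕ) → 3 ≤ r → (φ : ExactSAT r) →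
    WcolAtMost r (G φ) (2 * r ∸ 1) → Satisfiable φ
lemma4 (suc (suc (suc s))) (s≤s (s≤s (s≤s z≤n))) φ (σ , bound) =
  assignment φ σ bound , assignment-satisfies φ σ bound
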